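{- Let $n\ge 2$ and let $P_n=v_1v_2\cdots v_n$ be a path whose vertices have positive integer initial weights (each at least $1$). If there is a sequence of acquisition moves after which $v_n$ is the only vertex with nonzero weight, then the initial weight of $v_n$ is at least $2^{n-2}$.
   Context: An acquisition move on a vertex-weighted graph consists of choosing adjacent vertices $u,v$ with current weights satisfying $w(u)\ge w(v)>0$ and transferring all of the weight of $v$ to $u$ (so $w(u)$ becomes $w(u)+w(v)$ and $w(v)$ becomes $0$). -}

module Defs where

open import Data.Nat using (ℕ; suc; _+_; _≤_; _<_; _^_; _∸_)
open import Data.Fin using (Fin; toℕ)
open import Data.Product using (_×_; ∃-syntax)
open import Data.Sum using (_⊎_)
open import Relation.Binary.PropositionalEquality using (_≡_; _≢_)
open import Relation.Binary.Construct.Closure.ReflexiveTransitive using (Star)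

-- Vertex-weightings of the path P_n = v_1 ... v_n, with vertex v_{i+1} encoded as i : Fin n.
Weighting : ℕ → Set
Weighting n = Fin n → ℕ

PathAdj : ∀ {n} → Fin n → Fin n → Set
PathAdj u v = (suc (toℕ u) ≡ toℕ v) ⊎ (suc (toℕ v) ≡ toℕ u)

AcqMove : ∀ {n} → Weighting n → Weighting n → Set
AcqMove {n} w w' =
  ∃[ u ] ∃[ v ]
    ( PathAdj u v
    × (w v ≤ w u)
    × (0 < w v)
    × (w' u ≡ w u + w v)
    × (w' v ≡ 0)
    × (∀ x → x ≢ u → x ≢ v → w' x ≡ w x) )

AcqSeq : ∀ {n} → Weighting n → Weighting n → Set
AcqSeq = Star AcqMove

-- Call a weighting dominated if every vertex weighs at least the total weight to
-- its left.  A weighting concentrated on v_n is dominated, and undoing a move keeps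
-- a weighting dominated: the emptied vertex forces everything to its left to be
-- empty, so the move cannot have gone leftwards, and undoing a move from v to v+1
-- only changes the prefix sums at v+1, where w(v) ≤ w(v+1) is exactly what is
-- needed.  So the initial weighting is dominated, hence its prefix sums double from
-- w(v_1) ≥ 1 onwards and w(v_n) ≥ w(v_1) + ... + w(v_{n-1}) ≥ 2^{n-2}.
module Submission where

open import Defs
open import Data.Nat using (ℕ; zero; suc; _+_; _≤_; _<_; _^_; _∸_; z≤n; s≤s; _<?_)
open import Data.Nat.Properties
open import Data.Fin as Fin using (Fin; toℕ; fromℕ; fromℕ<)
open import Data.Fin.Properties using (toℕ<n; toℕ-fromℕ; toℕ-fromℕ<)
open import Data.Product using (_×_; _,_; ∃-syntax)
open import Data.Sum using (inj₁; inj₂)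
open import Data.Empty using (⊥-elim)
open import Function using (_∘_)
open import Relation.Binary using (tri<; tri≈; tri>)
open import Relation.Binary.PropositionalEquality
  using (_≡_; _≢_; refl; sym; trans; cong; cong₂; subst; subst₂; ≢-sym)
open import Relation.Binary.Construct.Closure.ReflexiveTransitive using (ε; _◅_)
open import Relation.Nullary using (yes; no)

-- Weightings as ℕ-indexed sequences, extended by zeros past the last vertex.
atℕ : ∀ {n} → Weighting n → ℕ → ℕ
atℕ {zero}  w k       = 0
atℕ {suc n} w zero    = w Fin.zero
atℕ {suc n} w (suc k) = atℕ (w ∘ Fin.suc) k

atℕ-toℕ : ∀ {n} (w : Weighting n) (i : Fin n) → atℕ w (toℕ i) ≡ w i
atℕ-toℕ w Fin.zero    = refl
atℕ-toℕ w (Fin.suc i) = atℕ-toℕ (w ∘ Fin.suc) i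

atℕ-fromℕ< : ∀ {n k} (w : Weighting n) (k<n : k < n) → atℕ w k ≡ w (fromℕ< k<n)
atℕ-fromℕ< w k<n = subst (λ j → atℕ w j ≡ w (fromℕ< k<n)) (toℕ-fromℕ< k<n) (atℕ-toℕ w (fromℕ< k<n))

atℕ-fromℕ : ∀ {m} (w : Weighting (suc m)) → atℕ w m ≡ w (fromℕ m)
atℕ-fromℕ {m} w = trans (cong (atℕ w) (sym (toℕ-fromℕ m))) (atℕ-toℕ w (fromℕ m))

atℕ-zeros-below-last : ∀ {m} (w : Weighting (suc m)) → (∀ x → x ≢ fromℕ m → w x ≡ 0) →
                       ∀ i → suc i < suc m → atℕ w i ≡ 0
atℕ-zeros-below-last {m} w zeros i 1+i<1+m =
  trans (atℕ-fromℕ< w i<1+m) (zeros (fromℕ< i<1+m) (<⇒≢ (≤-pred 1+i<1+m) ∘ toℕ-≡))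
  where
  i<1+m : i < suc m
  i<1+m = <⇒≤ 1+i<1+m
  toℕ-≡ : fromℕ< i<1+m ≡ fromℕ m → i ≡ m
  toℕ-≡ e = trans (sym (toℕ-fromℕ< i<1+m)) (trans (cong toℕ e) (toℕ-fromℕ m))

atℕ-≥ : ∀ {n} (w : Weighting n) {k} → n ≤ k → atℕ w k ≡ 0
atℕ-≥ {zero}  w _         = refl
atℕ-≥ {suc n} w (s≤s n≤k) = atℕ-≥ (w ∘ Fin.suc) n≤k

atℕ-cong-except : ∀ {n} {w w′ : Weighting n} {u v : Fin n} →
                  (∀ x → x ≢ u → x ≢ v → w′ x ≡ w x) →
                  ∀ k → k ≢ toℕ u → k ≢ toℕ v → atℕ w′ k ≡ atℕ w k
atℕ-cong-except {n} {w} {w′} agree k k≢u k≢v with k <? n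
... | yes k<n = trans (atℕ-fromℕ< w′ k<n)
                  (trans (agree x (k≢u ∘ toℕ-≡) (k≢v ∘ toℕ-≡)) (sym (atℕ-fromℕ< w k<n)))
  where
  x = fromℕ< k<n
  toℕ-≡ : ∀ {y} → x ≡ y → k ≡ toℕ y
  toℕ-≡ x≡y = trans (sym (toℕ-fromℕ< k<n)) (cong toℕ x≡y)
... | no k≮n = trans (atℕ-≥ w′ (≮⇒≥ k≮n)) (sym (atℕ-≥ w (≮⇒≥ k≮n)))

prefixSum : (ℕ → ℕ) → ℕ → ℕ
prefixSum g zero    = 0
prefixSum g (suc k) = prefixSum g k + g k

prefixSum-zeros : ∀ {g} k → (∀ i → i < k → g i ≡ 0) → prefixSum g k ≡ 0
prefixSum-zeros zero    zeros = refl
prefixSum-zeros (suc k) zeros =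
  cong₂ _+_ (prefixSum-zeros k (λ i i<k → zeros i (m<n⇒m<1+n i<k))) (zeros k ≤-refl)

prefixSum≡0⇒zeros : ∀ {g} k → prefixSum g k ≡ 0 → ∀ i → i < k → g i ≡ 0
prefixSum≡0⇒zeros {g} (suc k) sum≡0 i i<1+k with m≤n⇒m<n∨m≡n (≤-pred i<1+k)
... | inj₁ i<k  = prefixSum≡0⇒zeros k (m+n≡0⇒m≡0 (prefixSum g k) sum≡0) i i<k
... | inj₂ refl = m+n≡0⇒n≡0 (prefixSum g k) sum≡0

prefixSum-cong-from : ∀ {g h m} → prefixSum g m ≡ prefixSum h m →
                      (∀ i → m ≤ i → g i ≡ h i) →
                      ∀ {k} → m ≤ k → prefixSum g k ≡ prefixSum h k
prefixSum-cong-from start agree {zero} z≤n = refl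
prefixSum-cong-from start agree {suc k} m≤1+k with m≤n⇒m<n∨m≡n m≤1+k
... | inj₁ (s≤s m≤k) = cong₂ _+_ (prefixSum-cong-from start agree m≤k) (agree k m≤k)
... | inj₂ refl      = start

Dominated : ℕ → (ℕ → ℕ) → Set
Dominated n g = ∀ k → k < n → prefixSum g k ≤ g k

dominated-zeros-below : ∀ {n g a} → Dominated n g → a < n → g a ≡ 0 → ∀ i → i < a → g i ≡ 0
dominated-zeros-below {g = g} {a} dom a<n gₐ≡0 =
  prefixSum≡0⇒zeros a (n≤0⇒n≡0 (subst (prefixSum g a ≤_) gₐ≡0 (dom a a<n)))

dominated-if-zeros-below-last : ∀ {n g} → (∀ i → suc i < n → g i ≡ 0) → Dominated n g
dominated-if-zeros-below-last {g = g} zeros k k<n =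
  subst (_≤ g k) (sym (prefixSum-zeros k (λ i i<k → zeros i (<-≤-trans (s≤s i<k) k<n)))) z≤n

dominated-before-transfer : ∀ {n g h a} → a < n → g a ≤ g (suc a) →
                            h a ≡ 0 → h (suc a) ≡ g (suc a) + g a →
                            (∀ k → k ≢ a → k ≢ suc a → h k ≡ g k) →
                            Dominated n h → Dominated n g
dominated-before-transfer {n} {g} {h} {a} a<n gₐ≤ hₐ≡0 h₁₊ₐ others domH = dominated
  where
  open ≤-Reasoning
  h-zeros : ∀ i → i < a → h i ≡ 0
  h-zeros = dominated-zeros-below domH a<n hₐ≡0
  g-zeros : ∀ i → i < a → g i ≡ 0
  g-zeros i i<a = trans (sym (others i (<⇒≢ i<a) (<⇒≢ (m<n⇒m<1+n i<a)))) (h-zeros i i<a)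
  g≡h : ∀ i → suc (suc a) ≤ i → g i ≡ h i
  g≡h i 2+a≤i = sym (others i (≢-sym (<⇒≢ (<⇒≤ 2+a≤i))) (≢-sym (<⇒≢ 2+a≤i)))
  sums-agree : prefixSum g (suc (suc a)) ≡ prefixSum h (suc (suc a))
  sums-agree = E.begin
    prefixSum g a + g a + g (suc a)  E.≡⟨ cong (λ s → s + g a + g (suc a)) (prefixSum-zeros a g-zeros) ⟩
    g a + g (suc a)                  E.≡⟨ +-comm (g a) (g (suc a)) ⟩
    g (suc a) + g a                  E.≡⟨ sym h₁₊ₐ ⟩
    h (suc a)                        E.≡⟨ cong₂ (λ s t → s + t + h (suc a)) (prefixSum-zeros a h-zeros) hₐ≡0 ⟨
    prefixSum h a + h a + h (suc a)  E.∎
    where module E = Relation.Binary.PropositionalEquality.≡-Reasoning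
  dominated : Dominated n g
  dominated k k<n with <-cmp k (suc a)
  ... | tri< k<1+a _ _ =
    subst (_≤ g k) (sym (prefixSum-zeros k (λ i i<k → g-zeros i (<-≤-trans i<k (≤-pred k<1+a))))) z≤n
  ... | tri≈ _ refl _ = begin
    prefixSum g a + g a  ≡⟨ cong (_+ g a) (prefixSum-zeros a g-zeros) ⟩
    g a                  ≤⟨ gₐ≤ ⟩
    g (suc a)            ∎
  ... | tri> _ _ 1+a<k = begin
    prefixSum g k  ≡⟨ prefixSum-cong-from sums-agree g≡h 1+a<k ⟩
    prefixSum h k  ≤⟨ domH k k<n ⟩
    h k            ≡⟨ g≡h k 1+a<k ⟨
    g k            ∎

dominated-before-move : ∀ {n} {w w′ : Weighting n} → AcqMove w w′ →
                        Dominated n (atℕ w′) → Dominated n (atℕ w)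
dominated-before-move {n} {w} {w′} (u , v , adj , wv≤wu , 0<wv , w′u , w′v , others) dom
  with adj
... | inj₁ 1+u≡v = ⊥-elim (<⇒≢ 0<wv (sym (m+n≡0⇒n≡0 (w u) wu+wv≡0)))
  where
  wu+wv≡0 : w u + w v ≡ 0
  wu+wv≡0 = trans (sym w′u) (trans (sym (atℕ-toℕ w′ u))
              (dominated-zeros-below dom (toℕ<n v) (trans (atℕ-toℕ w′ v) w′v) (toℕ u) (≤-reflexive 1+u≡v)))
... | inj₂ 1+v≡u = dominated-before-transfer (toℕ<n v)
  (subst₂ _≤_ (sym (atℕ-toℕ w v)) (sym (atℕ-1+v w)) wv≤wu)
  (trans (atℕ-toℕ w′ v) w′v)
  (trans (atℕ-1+v w′) (trans w′u (cong₂ _+_ (sym (atℕ-1+v w)) (sym (atℕ-toℕ w v)))))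
  (λ k k≢v k≢1+v → atℕ-cong-except others k (λ k≡u → k≢1+v (trans k≡u (sym 1+v≡u))) k≢v)
  dom
  where
  atℕ-1+v : (x : Weighting n) → atℕ x (suc (toℕ v)) ≡ x u
  atℕ-1+v x = trans (cong (atℕ x) 1+v≡u) (atℕ-toℕ x u)

dominated-before-moves : ∀ {n} {w w′ : Weighting n} → AcqSeq w w′ →
                         Dominated n (atℕ w′) → Dominated n (atℕ w)
dominated-before-moves ε             dom = dom
dominated-before-moves (move ◅ moves) dom = dominated-before-move move (dominated-before-moves moves dom)

dominated-prefixSum-growth : ∀ {n g} → Dominated n g → 1 ≤ g 0 →
                             ∀ k → suc k < n → 2 ^ k ≤ prefixSum g (suc k)
dominated-prefixSum-growth dom 1≤g₀ zero    _      = 1≤g₀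
dominated-prefixSum-growth {g = g} dom 1≤g₀ (suc k) 2+k<n =
  subst (_≤ prefixSum g (suc (suc k))) (cong (2 ^ k +_) (sym (+-identityʳ (2 ^ k))))
    (+-mono-≤ ih (≤-trans ih (dom (suc k) (<⇒≤ 2+k<n))))
  where
  ih : 2 ^ k ≤ prefixSum g (suc k)
  ih = dominated-prefixSum-growth dom 1≤g₀ k (<⇒≤ 2+k<n)

lemma2p1 : (m : ℕ) → 2 ≤ suc m → (w : Weighting (suc m)) → (∀ i → 1 ≤ w i)
    → (∃[ w' ] (AcqSeq w w' × (∀ x → x ≢ fromℕ m → w' x ≡ 0) × (0 < w' (fromℕ m))))
    → 2 ^ (suc m ∸ 2) ≤ w (fromℕ m)
lemma2p1 zero (s≤s ())
lemma2p1 (suc m) _ w positive (w′ , moves , empty-but-last , _) = begin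
  2 ^ m                     ≤⟨ dominated-prefixSum-growth dom (positive Fin.zero) m ≤-refl ⟩
  prefixSum (atℕ w) (suc m) ≤⟨ dom (suc m) ≤-refl ⟩
  atℕ w (suc m)             ≡⟨ atℕ-fromℕ w ⟩
  w (fromℕ (suc m))         ∎
  where
  open ≤-Reasoning
  dom : Dominated (suc (suc m)) (atℕ w)
  dom = dominated-before-moves moves (dominated-if-zeros-below-last (atℕ-zeros-below-last w′ empty-but-last))
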